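{- Let $k$ be an odd positive integer such that $5k+2$ is prime, and let $m,r\in\mathbb{N}$. Then $$F_{m(5k+r)}\equiv F_{mr}F_{3m-1}-F_{mr-1}F_{3m}\pmod{5k+2}.$$
   Context: $(F_n)_{n\ge 0}$ denotes the Fibonacci sequence: $F_0=0$, $F_1=1$, $F_{n+2}=F_{n+1}+F_n$. $\mathbb{N}$ denotes the natural numbers. -}

module Defs where

open import Data.Nat using (ℕ; zero; suc)
open import Data.Integer using (ℤ; +_; -[1+_]; _+_; -_)

fib : ℕ → ℕ
fib zero = 0
fib (suc zero) = 1
fib (suc (suc n)) = fib (suc n) Data.Nat.+ fib n

-- Fibonacci numbers extended to integer indices by the same recurrence:
-- F_{-n} = (-1)^{n+1} F_n.  (Needed for F_{mr-1}, F_{3m-1} when mr = 0 or m = 0,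
-- where F_{-1} = 1.)
fibℤ : ℤ → ℤ
fibℤ (+ n) = + fib n
fibℤ -[1+ n ] = sgn n (+ fib (suc n))
  where
  -- index -(n+1): sign (-1)^{n+2} = (-1)^n
  sgn : ℕ → ℤ → ℤ
  sgn zero x = x
  sgn (suc zero) x = - x
  sgn (suc (suc j)) x = sgn j x

-- Work in ℤ[φ] = ℤ[x]/(x² − x − 1), where φⁿ = F_{n−1} + F_n φ and the conjugate ψ = 1 − φ
-- satisfies ψⁿ = F_{n+1} − F_n φ and φψ = −1.  For k odd, p = 5k + 2 ≡ 7 (mod 10), so by
-- Gauss's lemma 5^((p−1)/2) ≡ −1 (mod p).  With √5 = 2φ − 1 the freshman's dream gives
-- (2φ)^p = (1 + √5)^p ≡ 1 + 5^((p−1)/2) √5 ≡ 1 − √5 = 2ψ, and as 2^p ≡ 2 this means φ^p ≡ ψ,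
-- so φ^(5k) = φ^(p−2) ≡ ψ³.  Therefore φ^(mr + 5km) ≡ φ^(mr) ψ^(3m), and comparing
-- φ-coefficients gives the congruence.
module Submission where

open import Data.Nat as ℕ using (ℕ; zero; suc; _∸_; _%_; _/_; s≤s; z≤n)
import Data.Nat
import Data.Nat.Properties as ℕ
import Data.Nat.Divisibility as ℕ
open import Data.Nat.DivMod using (m≡m%n+[m/n]*n)
open import Data.Nat.Combinatorics using (_C_; nCn≡1; nC1≡n; nCk+nC[k+1]≡[n+1]C[k+1])
open import Data.Nat.Primality using (Prime; euclidsLemma; prime⇒nonTrivial)
open import Data.Nat.Tactic.RingSolver using () renaming (solve-∀ to ℕ-solve-∀)
import Data.Integer as ℤ
open import Data.Integer using (ℤ; +_)
import Data.Integer.Properties as ℤ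
open import Data.Integer.Divisibility using (_∣_)
open import Data.Integer.Divisibility.Signed as Signed using (divides; ∣m∣n⇒∣m+n; ∣m⇒∣-m; ∣m⇒∣m*n; ∣n⇒∣m*n; ∣ᵤ⇒∣; ∣⇒∣ᵤ)
open import Data.Integer.Tactic.RingSolver using () renaming (solve-∀ to ℤ-solve-∀)
open import Data.Fin using (Fin; zero; suc; toℕ; inject₁)
open import Data.Fin.Properties using (toℕ-inject₁; toℕ-fromℕ; toℕ<n)
open import Data.Vec.Functional using (init; last; tail)
import Data.Product as Product
open import Data.Product using (_,_; ∃-syntax)
open import Data.Sum using (_⊎_; inj₁; inj₂)
open import Level using (0ℓ)
open import Relation.Nullary using (¬_; contradiction)
open import Relation.Binary.Bundles using (Setoid)
open import Relation.Binary.PropositionalEquality using (_≡_; refl; sym; trans; cong; cong₂; subst; isEquivalence; module ≡-Reasoning)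
import Relation.Binary.Reasoning.Setoid
open import Algebra.Bundles using (CommutativeSemiring)
open import Defs using (fib; fibℤ)

[1+k]*[1+n]C[1+k]≡[1+n]*nCk : ∀ n k → suc k ℕ.* (suc n C suc k) ≡ suc n ℕ.* (n C k)
[1+k]*[1+n]C[1+k]≡[1+n]*nCk zero    zero    = refl
[1+k]*[1+n]C[1+k]≡[1+n]*nCk zero    (suc k) = ℕ.*-zeroʳ (suc (suc k))
[1+k]*[1+n]C[1+k]≡[1+n]*nCk (suc n) zero    =
  trans (ℕ.+-identityʳ _) (trans (nC1≡n (suc (suc n))) (sym (ℕ.*-identityʳ _)))
[1+k]*[1+n]C[1+k]≡[1+n]*nCk (suc n) (suc k) = begin
  (2 ℕ.+ k) ℕ.* ((2 ℕ.+ n) C (2 ℕ.+ k))                      ≡⟨ cong ((2 ℕ.+ k) ℕ.*_) (pascal (suc n) (suc k)) ⟨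
  (2 ℕ.+ k) ℕ.* (a ℕ.+ b)                                    ≡⟨ rearrange k a b ⟩
  (1 ℕ.+ k) ℕ.* a ℕ.+ a ℕ.+ (2 ℕ.+ k) ℕ.* b
    ≡⟨ cong₂ (λ u v → u ℕ.+ a ℕ.+ v) ([1+k]*[1+n]C[1+k]≡[1+n]*nCk n k) ([1+k]*[1+n]C[1+k]≡[1+n]*nCk n (suc k)) ⟩
  (1 ℕ.+ n) ℕ.* (n C k) ℕ.+ a ℕ.+ (1 ℕ.+ n) ℕ.* (n C suc k)  ≡⟨ collect n (n C k) (n C suc k) a ⟩
  (1 ℕ.+ n) ℕ.* (n C k ℕ.+ n C suc k) ℕ.+ a                  ≡⟨ cong (λ c → (1 ℕ.+ n) ℕ.* c ℕ.+ a) (pascal n k) ⟩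
  (1 ℕ.+ n) ℕ.* a ℕ.+ a                                      ≡⟨ ℕ.+-comm ((1 ℕ.+ n) ℕ.* a) a ⟩
  (2 ℕ.+ n) ℕ.* a                                            ∎
  where
  open ≡-Reasoning
  pascal : ∀ n k → n C k ℕ.+ n C suc k ≡ suc n C suc k
  pascal = nCk+nC[k+1]≡[n+1]C[k+1]
  a b : ℕ
  a = suc n C suc k
  b = suc n C suc (suc k)
  rearrange : ∀ k a b → (2 ℕ.+ k) ℕ.* (a ℕ.+ b) ≡ (1 ℕ.+ k) ℕ.* a ℕ.+ a ℕ.+ (2 ℕ.+ k) ℕ.* b
  rearrange = ℕ-solve-∀
  collect : ∀ n x y a → (1 ℕ.+ n) ℕ.* x ℕ.+ a ℕ.+ (1 ℕ.+ n) ℕ.* y ≡ (1 ℕ.+ n) ℕ.* (x ℕ.+ y) ℕ.+ a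
  collect = ℕ-solve-∀

prime∣pCk : ∀ {p k} → Prime p → 0 ℕ.< k → k ℕ.< p → p ℕ.∣ p C k
prime∣pCk {suc q} {suc i} pr _ (s≤s i<q) with euclidsLemma (suc i) (suc q C suc i) pr p∣[1+i]*pC[1+i]
  where
  p∣[1+i]*pC[1+i] : suc q ℕ.∣ suc i ℕ.* (suc q C suc i)
  p∣[1+i]*pC[1+i] = ℕ.divides (q C i) (trans ([1+k]*[1+n]C[1+k]≡[1+n]*nCk q i) (ℕ.*-comm (suc q) (q C i)))
... | inj₂ p∣pCk = p∣pCk
... | inj₁ p∣k   = contradiction (ℕ.∣⇒≤ p∣k) (ℕ.<⇒≱ (s≤s i<q))

module _ {c ℓ} (S : CommutativeSemiring c ℓ) where

  open CommutativeSemiring S hiding (zero; refl; sym) renaming (trans to ≈-trans)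
  open import Algebra.Properties.Semiring.Exp semiring using (_^_)
  open import Algebra.Properties.Semiring.Mult semiring using (_×_; ×-homo-1; ×-congʳ; ×-assocˡ; ×-assoc-*)
  open import Algebra.Properties.Semiring.Sum semiring using (sum; sum-init-last; *-distribˡ-sum; sum-cong-≋)
  import Algebra.Properties.CommutativeSemiring.Binomial S as Binomial
  open import Relation.Binary.Reasoning.Setoid setoid

  ×-distrib-sum : ∀ m {n} (z : Fin n → Carrier) → sum (λ i → m × z i) ≈ m × sum z
  ×-distrib-sum m z = begin
    sum (λ i → m × z i)             ≈⟨ sum-cong-≋ (λ i → ×-as-* (z i)) ⟩
    sum (λ i → (m × 1#) * z i)      ≈⟨ *-distribˡ-sum (m × 1#) z ⟨
    (m × 1#) * sum z                ≈⟨ ×-as-* (sum z) ⟨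
    m × sum z                       ∎
    where
    ×-as-* : ∀ x → m × x ≈ (m × 1#) * x
    ×-as-* x = begin
      m × x            ≈⟨ ×-congʳ m (*-identityˡ x) ⟨
      m × (1# * x)     ≈⟨ ×-assoc-* m 1# x ⟨
      (m × 1#) * x     ∎

  freshmans-dream : ∀ {p} → Prime p → ∀ x y → ∃[ M ] (x + y) ^ p ≈ x ^ p + y ^ p + p × M
  freshmans-dream {suc q} pr x y = M , (begin
    (x + y) ^ p                                     ≈⟨ Binomial.theorem p x y ⟩
    t zero + sum (tail t)                           ≈⟨ +-congˡ (sum-init-last (tail t)) ⟩
    t zero + (sum (init (tail t)) + last (tail t))  ≈⟨ +-cong first-term (+-cong middle-terms last-term) ⟩
    y ^ p + (p × M + x ^ p)                         ≈⟨ +-congˡ (+-comm (p × M) (x ^ p)) ⟩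
    y ^ p + (x ^ p + p × M)                         ≈⟨ +-assoc (y ^ p) (x ^ p) (p × M) ⟨
    y ^ p + x ^ p + p × M                           ≈⟨ +-congʳ (+-comm (y ^ p) (x ^ p)) ⟩
    x ^ p + y ^ p + p × M                           ∎)
    where
    p : ℕ
    p = suc q

    t b : Fin (suc p) → Carrier
    t = Binomial.binomialTerm x y p
    b = Binomial.binomial x y p

    p∣coefficient : ∀ (i : Fin q) → p ℕ.∣ p C suc (toℕ (inject₁ i))
    p∣coefficient i = prime∣pCk pr (s≤s z≤n) (s≤s (subst (ℕ._< q) (sym (toℕ-inject₁ i)) (toℕ<n i)))

    quotient : Fin q → ℕ
    quotient i = ℕ._∣_.quotient (p∣coefficient i)

    summand : Fin q → Carrier
    summand i = quotient i × b (suc (inject₁ i))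

    M : Carrier
    M = sum summand

    middle-term : ∀ i → t (suc (inject₁ i)) ≈ p × summand i
    middle-term i = begin
      t (suc (inject₁ i))                     ≡⟨ cong (_× b (suc (inject₁ i))) p-divides ⟩
      (p ℕ.* quotient i) × b (suc (inject₁ i)) ≈⟨ ×-assocˡ (b (suc (inject₁ i))) p (quotient i) ⟨
      p × summand i                           ∎
      where
      p-divides : p C suc (toℕ (inject₁ i)) ≡ p ℕ.* quotient i
      p-divides = trans (ℕ._∣_.equality (p∣coefficient i)) (ℕ.*-comm (quotient i) p)

    middle-terms : sum (init (tail t)) ≈ p × M
    middle-terms = ≈-trans (sum-cong-≋ middle-term) (×-distrib-sum p summand)

    first-term : t zero ≈ y ^ p
    first-term = ≈-trans (×-homo-1 _) (*-identityˡ _)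

    last-term : last (tail t) ≈ x ^ p
    last-term rewrite toℕ-fromℕ q | nCn≡1 p | ℕ.n∸n≡0 q = ≈-trans (×-homo-1 _) (*-identityʳ _)

open Data.Integer using (_+_; _*_; -_; _-_)

-- A record rather than a synonym for n ∣ x - y, so that x, y and n can be inferred.
infix 4 _≡_mod_
record _≡_mod_ (x y n : ℤ) : Set where
  constructor mod-∣
  field
    ∣-difference : n Signed.∣ x - y

open _≡_mod_

module _ {n : ℤ} where

  ≡⇒≡-mod : ∀ {x y} → x ≡ y → x ≡ y mod n
  ≡⇒≡-mod {x} refl = mod-∣ (divides (+ 0) (ℤ.+-inverseʳ x))

  ≡-mod-sym : ∀ {x y} → x ≡ y mod n → y ≡ x mod n
  ≡-mod-sym {x} {y} (mod-∣ n∣x-y) = mod-∣ (subst (n Signed.∣_) (lemma x y) (∣m⇒∣-m n∣x-y))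
    where
    lemma : ∀ x y → - (x - y) ≡ y - x
    lemma = ℤ-solve-∀

  ≡-mod-trans : ∀ {x y z} → x ≡ y mod n → y ≡ z mod n → x ≡ z mod n
  ≡-mod-trans {x} {y} {z} (mod-∣ n∣x-y) (mod-∣ n∣y-z) =
    mod-∣ (subst (n Signed.∣_) (ℤ.+-minus-telescope x y z) (∣m∣n⇒∣m+n n∣x-y n∣y-z))

  +-cong-mod : ∀ {x y u v} → x ≡ y mod n → u ≡ v mod n → x + u ≡ y + v mod n
  +-cong-mod {x} {y} {u} {v} (mod-∣ n∣x-y) (mod-∣ n∣u-v) =
    mod-∣ (subst (n Signed.∣_) (lemma x y u v) (∣m∣n⇒∣m+n n∣x-y n∣u-v))
    where
    lemma : ∀ x y u v → (x - y) + (u - v) ≡ (x + u) - (y + v)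
    lemma = ℤ-solve-∀

  *-cong-mod : ∀ {x y u v} → x ≡ y mod n → u ≡ v mod n → x * u ≡ y * v mod n
  *-cong-mod {x} {y} {u} {v} (mod-∣ n∣x-y) (mod-∣ n∣u-v) =
    mod-∣ (subst (n Signed.∣_) (lemma x y u v) (∣m∣n⇒∣m+n (∣m⇒∣m*n u n∣x-y) (∣n⇒∣m*n y n∣u-v)))
    where
    lemma : ∀ x y u v → (x - y) * u + y * (u - v) ≡ x * u - y * v
    lemma = ℤ-solve-∀

  +-*-≡-mod : ∀ x k → x + n * k ≡ x mod n
  +-*-≡-mod x k = mod-∣ (divides k (lemma x k n))
    where
    lemma : ∀ x k n → x + n * k - x ≡ k * n
    lemma = ℤ-solve-∀

≡-mod-setoid : ℤ → Setoid 0ℓ 0ℓ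
≡-mod-setoid n = record
  { Carrier = ℤ
  ; _≈_ = λ x y → x ≡ y mod n
  ; isEquivalence = record { refl = ≡⇒≡-mod refl ; sym = ≡-mod-sym ; trans = ≡-mod-trans }
  }

module ≡-mod-Reasoning (n : ℤ) = Relation.Binary.Reasoning.Setoid (≡-mod-setoid n)

prime-∣-*⇒∣⊎∣ : ∀ {p} → Prime p → ∀ {x y} → + p Signed.∣ x * y → + p Signed.∣ x ⊎ + p Signed.∣ y
prime-∣-*⇒∣⊎∣ {p} pr {x} {y} p∣xy with euclidsLemma ℤ.∣ x ∣ ℤ.∣ y ∣ pr (subst (p ℕ.∣_) (ℤ.abs-* x y) (∣⇒∣ᵤ p∣xy))
... | inj₁ p∣x = inj₁ (∣ᵤ⇒∣ p∣x)
... | inj₂ p∣y = inj₂ (∣ᵤ⇒∣ p∣y)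

*-cancelˡ-≡-mod : ∀ {p} → Prime p → ∀ {c x y} → ¬ (+ p Signed.∣ c) → c * x ≡ c * y mod + p → x ≡ y mod + p
*-cancelˡ-≡-mod pr {c} {x} {y} p∤c (mod-∣ p∣cx-cy) with prime-∣-*⇒∣⊎∣ pr (subst (_ Signed.∣_) (lemma c x y) p∣cx-cy)
  where
  lemma : ∀ c x y → c * x - c * y ≡ c * (x - y)
  lemma = ℤ-solve-∀
... | inj₁ p∣c = contradiction p∣c p∤c
... | inj₂ p∣x-y = mod-∣ p∣x-y

odd-prime∤2 : ∀ h → Prime (suc (2 ℕ.* h)) → ¬ (+ suc (2 ℕ.* h) Signed.∣ + 2)
odd-prime∤2 zero    pr _   = ℕ.<-irrefl refl (ℕ.nonTrivial⇒n>1 1 {{prime⇒nonTrivial pr}})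
odd-prime∤2 (suc h) pr p∣2 = ℕ.<⇒≱ 2<p (ℕ.∣⇒≤ (∣⇒∣ᵤ p∣2))
  where
  2<p : 2 ℕ.< suc (2 ℕ.* suc h)
  2<p = s≤s (s≤s (ℕ.≤-trans (s≤s z≤n) (ℕ.m≤n+m (suc (h ℕ.+ 0)) h)))

∏ : (ℕ → ℤ) → ℕ → ℤ
∏ f zero    = + 1
∏ f (suc n) = ∏ f n * f n

∏-+ : ∀ f m n → ∏ f (m ℕ.+ n) ≡ ∏ f m * ∏ (λ t → f (m ℕ.+ t)) n
∏-+ f m zero    rewrite ℕ.+-identityʳ m = sym (ℤ.*-identityʳ (∏ f m))
∏-+ f m (suc n) rewrite ℕ.+-suc m n | ∏-+ f m n = ℤ.*-assoc (∏ f m) _ _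

∏-suc : ∀ f n → ∏ f (suc n) ≡ f 0 * ∏ (λ t → f (suc t)) n
∏-suc f n = trans (∏-+ f 1 n) (cong (_* ∏ (λ t → f (suc t)) n) (ℤ.*-identityˡ (f 0)))

∏-reverse : ∀ f n → ∏ f n ≡ ∏ (λ t → f (n ∸ suc t)) n
∏-reverse f zero    = refl
∏-reverse f (suc n) = begin
  ∏ f n * f n                                  ≡⟨ cong (_* f n) (∏-reverse f n) ⟩
  ∏ (λ t → f (n ∸ suc t)) n * f n              ≡⟨ ℤ.*-comm _ (f n) ⟩
  f n * ∏ (λ t → f (n ∸ suc t)) n              ≡⟨ ∏-suc (λ t → f (suc n ∸ suc t)) n ⟨
  ∏ (λ t → f (suc n ∸ suc t)) (suc n)          ∎
  where open ≡-Reasoning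

∏-scale : ∀ c f n → ∏ (λ t → c * f t) n ≡ c ℤ.^ n * ∏ f n
∏-scale c f zero    = refl
∏-scale c f (suc n) rewrite ∏-scale c f n = lemma c (c ℤ.^ n) (∏ f n) (f n)
  where
  lemma : ∀ c e q x → e * q * (c * x) ≡ c * e * (q * x)
  lemma = ℤ-solve-∀

∏-cong-mod : ∀ {n} f g k → (∀ t → t ℕ.< k → f t ≡ g t mod n) → ∏ f k ≡ ∏ g k mod n
∏-cong-mod f g zero    f≡g = ≡⇒≡-mod refl
∏-cong-mod f g (suc k) f≡g = *-cong-mod (∏-cong-mod f g k (λ t t<k → f≡g t (ℕ.m<n⇒m<1+n t<k))) (f≡g k ℕ.≤-refl)

prime∤∏ : ∀ {p} → Prime p → ∀ f n → (∀ t → t ℕ.< n → ¬ (+ p Signed.∣ f t)) → ¬ (+ p Signed.∣ ∏ f n)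
prime∤∏ {p} pr f zero    p∤f p∣1 = ℕ.<⇒≱ (ℕ.nonTrivial⇒n>1 p {{prime⇒nonTrivial pr}}) (ℕ.∣⇒≤ (∣⇒∣ᵤ p∣1))
prime∤∏ {p} pr f (suc n) p∤f p∣∏ with prime-∣-*⇒∣⊎∣ pr p∣∏
... | inj₁ p∣∏f = prime∤∏ pr f n (λ t t<n → p∤f t (ℕ.m<n⇒m<1+n t<n)) p∣∏f
... | inj₂ p∣fn = p∤f n ℕ.≤-refl p∣fn

5t+ : ℕ → ℕ → ℤ
5t+ c t = + (5 ℕ.* t ℕ.+ c)

factorial-by-residues : ∀ j →
  ∏ (λ t → + suc t) (5 ℕ.* j ℕ.+ 3) ≡ ∏ (5t+ 5) j * ∏ (5t+ 2) (suc j) * ∏ (5t+ 3) (suc j) * ∏ (5t+ 4) j * ∏ (5t+ 1) (suc j)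
factorial-by-residues zero    = refl
factorial-by-residues (suc j) = begin
  ∏ f (5 ℕ.* suc j ℕ.+ 3)                                             ≡⟨ cong (∏ f) (5[1+j]+3 j) ⟩
  ∏ f x * f x * f (1 ℕ.+ x) * f (2 ℕ.+ x) * f (3 ℕ.+ x) * f (4 ℕ.+ x)
    ≡⟨ regroup (∏ (5t+ 5) j) (∏ (5t+ 2) (suc j)) (∏ (5t+ 3) (suc j)) (∏ (5t+ 4) j) (∏ (5t+ 1) (suc j))
                (factorial-by-residues j) (cong +_ (e₄ j)) (cong +_ (e₅ j)) (cong +_ (e₁ j)) (cong +_ (e₂ j)) (cong +_ (e₃ j)) ⟩
  ∏ (5t+ 5) (suc j) * ∏ (5t+ 2) (2 ℕ.+ j) * ∏ (5t+ 3) (2 ℕ.+ j) * ∏ (5t+ 4) (suc j) * ∏ (5t+ 1) (2 ℕ.+ j) ∎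
  where
  open ≡-Reasoning
  f : ℕ → ℤ
  f t = + suc t
  x : ℕ
  x = 5 ℕ.* j ℕ.+ 3
  5[1+j]+3 : ∀ j → 5 ℕ.* suc j ℕ.+ 3 ≡ 5 ℕ.+ (5 ℕ.* j ℕ.+ 3)
  5[1+j]+3 = ℕ-solve-∀
  e₄ : ∀ j → suc (5 ℕ.* j ℕ.+ 3) ≡ 5 ℕ.* j ℕ.+ 4
  e₄ = ℕ-solve-∀
  e₅ : ∀ j → suc (1 ℕ.+ (5 ℕ.* j ℕ.+ 3)) ≡ 5 ℕ.* j ℕ.+ 5
  e₅ = ℕ-solve-∀
  e₁ : ∀ j → suc (2 ℕ.+ (5 ℕ.* j ℕ.+ 3)) ≡ 5 ℕ.* suc j ℕ.+ 1
  e₁ = ℕ-solve-∀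
  e₂ : ∀ j → suc (3 ℕ.+ (5 ℕ.* j ℕ.+ 3)) ≡ 5 ℕ.* suc j ℕ.+ 2
  e₂ = ℕ-solve-∀
  e₃ : ∀ j → suc (4 ℕ.+ (5 ℕ.* j ℕ.+ 3)) ≡ 5 ℕ.* suc j ℕ.+ 3
  e₃ = ℕ-solve-∀
  regroup : ∀ A B G D E {X a b c d e a′ b′ c′ d′ e′} → X ≡ A * B * G * D * E →
            a ≡ d′ → b ≡ a′ → c ≡ e′ → d ≡ b′ → e ≡ c′ →
            X * a * b * c * d * e ≡ A * a′ * (B * b′) * (G * c′) * (D * d′) * (E * e′)
  regroup A B G D E {a = a} {b} {c} {d} {e} refl refl refl refl refl refl = lemma A B G D E a b c d e
    where
    lemma : ∀ A B G D E a b c d e → A * B * G * D * E * a * b * c * d * e ≡ A * b * (B * d) * (G * e) * (D * a) * (E * c)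
    lemma = ℤ-solve-∀

ℕ≡+kn⇒≡-mod : ∀ {n a b} k → a ≡ b ℕ.+ k ℕ.* n → + a ≡ + b mod + n
ℕ≡+kn⇒≡-mod {n} {a} {b} k refl = mod-∣ (divides (+ k) (begin
  + (b ℕ.+ k ℕ.* n) - + b   ≡⟨ cong (_- + b) (ℤ.pos-+ b (k ℕ.* n)) ⟩
  + b + + (k ℕ.* n) - + b   ≡⟨ lemma (+ b) (+ (k ℕ.* n)) ⟩
  + (k ℕ.* n)               ≡⟨ ℤ.pos-* k n ⟩
  + k * + n                 ∎))
  where
  open ≡-Reasoning
  lemma : ∀ x y → x + y - x ≡ y
  lemma = ℤ-solve-∀

ℕ+≡kn⇒≡-neg-mod : ∀ {n a b} k → a ℕ.+ b ≡ k ℕ.* n → + a ≡ - + 1 * + b mod + n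
ℕ+≡kn⇒≡-neg-mod {n} {a} {b} k a+b≡kn = mod-∣ (divides (+ k) (begin
  + a - - + 1 * + b         ≡⟨ lemma (+ a) (+ b) ⟩
  + a + + b                 ≡⟨ ℤ.pos-+ a b ⟨
  + (a ℕ.+ b)               ≡⟨ cong +_ a+b≡kn ⟩
  + (k ℕ.* n)               ≡⟨ ℤ.pos-* k n ⟩
  + k * + n                 ∎))
  where
  open ≡-Reasoning
  lemma : ∀ x y → x - - + 1 * y ≡ x + y
  lemma = ℤ-solve-∀

[-1]^[1+j]*[-1]^j≡-1 : ∀ j → (- + 1) ℤ.^ suc j * (- + 1) ℤ.^ j ≡ - + 1
[-1]^[1+j]*[-1]^j≡-1 zero    = refl
[-1]^[1+j]*[-1]^j≡-1 (suc j) = trans (lemma ((- + 1) ℤ.^ j)) ([-1]^[1+j]*[-1]^j≡-1 j)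
  where
  lemma : ∀ s → - + 1 * (- + 1 * s) * (- + 1 * s) ≡ - + 1 * s * s
  lemma = ℤ-solve-∀

module _ (j : ℕ) where

  private
    p h : ℕ
    p = 10 ℕ.* j ℕ.+ 7
    h = 5 ℕ.* j ℕ.+ 3

    P : ℤ
    P = + p

    w : ℕ → ℤ
    w t = + 5 * + suc t

    w≡ : ∀ t → w t ≡ + (5 ℕ.* suc t)
    w≡ t = sym (ℤ.pos-* 5 (suc t))

    block₅ : ∏ w j ≡ ∏ (5t+ 5) j mod P
    block₅ = ∏-cong-mod w (5t+ 5) j (λ t _ → ≡⇒≡-mod (trans (w≡ t) (cong +_ (lemma t))))
      where
      lemma : ∀ t → 5 ℕ.* suc t ≡ 5 ℕ.* t ℕ.+ 5
      lemma = ℕ-solve-∀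

    block₂ : ∏ (λ t → w (j ℕ.+ t)) (suc j) ≡ (- + 1) ℤ.^ suc j * ∏ (5t+ 2) (suc j) mod P
    block₂ = ≡-mod-trans (∏-cong-mod _ (λ t → - + 1 * 5t+ 2 (j ∸ t)) (suc j) pointwise) (≡⇒≡-mod (begin
      ∏ (λ t → - + 1 * 5t+ 2 (j ∸ t)) (suc j)        ≡⟨ ∏-scale (- + 1) (λ t → 5t+ 2 (j ∸ t)) (suc j) ⟩
      (- + 1) ℤ.^ suc j * ∏ (λ t → 5t+ 2 (j ∸ t)) (suc j) ≡⟨ cong ((- + 1) ℤ.^ suc j *_) (∏-reverse (5t+ 2) (suc j)) ⟨
      (- + 1) ℤ.^ suc j * ∏ (5t+ 2) (suc j)          ∎))
      where
      open ≡-Reasoning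
      pointwise : ∀ t → t ℕ.< suc j → w (j ℕ.+ t) ≡ - + 1 * 5t+ 2 (j ∸ t) mod P
      -- Writing j as t + (j ∸ t) makes the needed identity polynomial.
      pointwise t (s≤s t≤j) = ≡-mod-trans (≡⇒≡-mod (w≡ (j ℕ.+ t))) (ℕ+≡kn⇒≡-neg-mod 1
        (subst (λ J → 5 ℕ.* suc (J ℕ.+ t) ℕ.+ (5 ℕ.* (j ∸ t) ℕ.+ 2) ≡ 1 ℕ.* (10 ℕ.* J ℕ.+ 7)) (ℕ.m+[n∸m]≡n t≤j) (lemma t (j ∸ t))))
        where
        lemma : ∀ t u → 5 ℕ.* suc (t ℕ.+ u ℕ.+ t) ℕ.+ (5 ℕ.* u ℕ.+ 2) ≡ 1 ℕ.* (10 ℕ.* (t ℕ.+ u) ℕ.+ 7)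
        lemma = ℕ-solve-∀

    block₃ : ∏ (λ t → w (j ℕ.+ (suc j ℕ.+ t))) (suc j) ≡ ∏ (5t+ 3) (suc j) mod P
    block₃ = ∏-cong-mod _ (5t+ 3) (suc j) (λ t _ → ≡-mod-trans (≡⇒≡-mod (w≡ _)) (ℕ≡+kn⇒≡-mod 1 (lemma j t)))
      where
      lemma : ∀ j t → 5 ℕ.* suc (j ℕ.+ (suc j ℕ.+ t)) ≡ 5 ℕ.* t ℕ.+ 3 ℕ.+ 1 ℕ.* (10 ℕ.* j ℕ.+ 7)
      lemma = ℕ-solve-∀

    block₄ : ∏ (λ t → w (j ℕ.+ (suc j ℕ.+ (suc j ℕ.+ t)))) j ≡ (- + 1) ℤ.^ j * ∏ (5t+ 4) j mod P
    block₄ = ≡-mod-trans (∏-cong-mod _ (λ t → - + 1 * 5t+ 4 (j ∸ suc t)) j pointwise) (≡⇒≡-mod (begin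
      ∏ (λ t → - + 1 * 5t+ 4 (j ∸ suc t)) j          ≡⟨ ∏-scale (- + 1) (λ t → 5t+ 4 (j ∸ suc t)) j ⟩
      (- + 1) ℤ.^ j * ∏ (λ t → 5t+ 4 (j ∸ suc t)) j  ≡⟨ cong ((- + 1) ℤ.^ j *_) (∏-reverse (5t+ 4) j) ⟨
      (- + 1) ℤ.^ j * ∏ (5t+ 4) j                    ∎))
      where
      open ≡-Reasoning
      pointwise : ∀ t → t ℕ.< j → w (j ℕ.+ (suc j ℕ.+ (suc j ℕ.+ t))) ≡ - + 1 * 5t+ 4 (j ∸ suc t) mod P
      pointwise t t<j = ≡-mod-trans (≡⇒≡-mod (w≡ _)) (ℕ+≡kn⇒≡-neg-mod 2
        (subst (λ J → 5 ℕ.* suc (J ℕ.+ (suc J ℕ.+ (suc J ℕ.+ t))) ℕ.+ (5 ℕ.* (j ∸ suc t) ℕ.+ 4) ≡ 2 ℕ.* (10 ℕ.* J ℕ.+ 7))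
               (ℕ.m+[n∸m]≡n t<j) (lemma t (j ∸ suc t))))
        where
        lemma : ∀ t u → 5 ℕ.* suc (suc t ℕ.+ u ℕ.+ (suc (suc t ℕ.+ u) ℕ.+ (suc (suc t ℕ.+ u) ℕ.+ t))) ℕ.+ (5 ℕ.* u ℕ.+ 4)
                        ≡ 2 ℕ.* (10 ℕ.* (suc t ℕ.+ u) ℕ.+ 7)
        lemma = ℕ-solve-∀

    block₁ : ∏ (λ t → w (j ℕ.+ (suc j ℕ.+ (suc j ℕ.+ (j ℕ.+ t))))) (suc j) ≡ ∏ (5t+ 1) (suc j) mod P
    block₁ = ∏-cong-mod _ (5t+ 1) (suc j) (λ t _ → ≡-mod-trans (≡⇒≡-mod (w≡ _)) (ℕ≡+kn⇒≡-mod 2 (lemma j t)))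
      where
      lemma : ∀ j t → 5 ℕ.* suc (j ℕ.+ (suc j ℕ.+ (suc j ℕ.+ (j ℕ.+ t)))) ≡ 5 ℕ.* t ℕ.+ 1 ℕ.+ 2 ℕ.* (10 ℕ.* j ℕ.+ 7)
      lemma = ℕ-solve-∀

    h! : ℤ
    h! = ∏ (λ t → + suc t) h

    -- Gauss's lemma: modulo p the multiples 5, 10, …, 5h are ±1, …, ±h in some order, with
    -- a minus sign exactly for the 2j + 1 of them lying in (p/2, p) or (3p/2, 2p).
    ∏w≡-h! : ∏ w h ≡ - h! mod P
    ∏w≡-h! = begin
      ∏ w h                                                  ≡⟨ split ⟩
      ∏ w j * (∏ w₁ (suc j) * (∏ w₂ (suc j) * (∏ w₃ j * ∏ w₄ (suc j))))
        ≈⟨ *-cong-mod block₅ (*-cong-mod block₂ (*-cong-mod block₃ (*-cong-mod block₄ block₁))) ⟩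
      Π₅ * ((- + 1) ℤ.^ suc j * Π₂ * (Π₃ * ((- + 1) ℤ.^ j * Π₄ * Π₁)))
        ≡⟨ signs Π₅ Π₂ Π₃ Π₄ Π₁ ((- + 1) ℤ.^ suc j) ((- + 1) ℤ.^ j) ([-1]^[1+j]*[-1]^j≡-1 j) ⟩
      - (Π₅ * Π₂ * Π₃ * Π₄ * Π₁)                             ≡⟨ cong -_ (factorial-by-residues j) ⟨
      - h!                                                   ∎
      where
      open ≡-mod-Reasoning P
      w₁ w₂ w₃ w₄ : ℕ → ℤ
      w₁ t = w (j ℕ.+ t)
      w₂ t = w₁ (suc j ℕ.+ t)
      w₃ t = w₂ (suc j ℕ.+ t)
      w₄ t = w₃ (j ℕ.+ t)
      Π₁ Π₂ Π₃ Π₄ Π₅ : ℤ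
      Π₁ = ∏ (5t+ 1) (suc j)
      Π₂ = ∏ (5t+ 2) (suc j)
      Π₃ = ∏ (5t+ 3) (suc j)
      Π₄ = ∏ (5t+ 4) j
      Π₅ = ∏ (5t+ 5) j
      h-split : ∀ j → 5 ℕ.* j ℕ.+ 3 ≡ j ℕ.+ (suc j ℕ.+ (suc j ℕ.+ (j ℕ.+ suc j)))
      h-split = ℕ-solve-∀
      split : ∏ w h ≡ ∏ w j * (∏ w₁ (suc j) * (∏ w₂ (suc j) * (∏ w₃ j * ∏ w₄ (suc j))))
      split = trans (cong (∏ w) (h-split j))
        (trans (∏-+ w j _) (cong (∏ w j *_)
        (trans (∏-+ w₁ (suc j) _) (cong (∏ w₁ (suc j) *_)
        (trans (∏-+ w₂ (suc j) _) (cong (∏ w₂ (suc j) *_) (∏-+ w₃ j _)))))))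
      signs : ∀ a b c d e s₁ s₀ → s₁ * s₀ ≡ - + 1 → a * (s₁ * b * (c * (s₀ * d * e))) ≡ - (a * b * c * d * e)
      signs a b c d e s₁ s₀ s₁s₀≡-1 =
        trans (lemma a b c d e s₁ s₀) (trans (cong (λ s → s * (a * b * c * d * e)) s₁s₀≡-1) (lemma₂ _))
        where
        lemma : ∀ a b c d e s₁ s₀ → a * (s₁ * b * (c * (s₀ * d * e))) ≡ s₁ * s₀ * (a * b * c * d * e)
        lemma = ℤ-solve-∀
        lemma₂ : ∀ x → - + 1 * x ≡ - x
        lemma₂ = ℤ-solve-∀

  5^[5j+3]≡-1 : Prime p → (+ 5) ℤ.^ h ≡ - + 1 mod P
  5^[5j+3]≡-1 pr = *-cancelˡ-≡-mod pr p∤h! (begin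
    h! * (+ 5) ℤ.^ h    ≡⟨ ℤ.*-comm h! _ ⟩
    (+ 5) ℤ.^ h * h!    ≡⟨ ∏-scale (+ 5) (λ t → + suc t) h ⟨
    ∏ w h               ≈⟨ ∏w≡-h! ⟩
    - h!                ≡⟨ lemma h! ⟩
    h! * - + 1          ∎)
    where
    open ≡-mod-Reasoning P
    lemma : ∀ x → - x ≡ x * - + 1
    lemma = ℤ-solve-∀
    h<p : h ℕ.< p
    h<p = ℕ.+-mono-≤-< (ℕ.*-monoˡ-≤ j (ℕ.≤ᵇ⇒≤ 5 10 _)) (ℕ.≤ᵇ⇒≤ 4 7 _)
    p∤h! : ¬ (P Signed.∣ h!)
    p∤h! = prime∤∏ pr (λ t → + suc t) h (λ t t<h p∣1+t → ℕ.<⇒≱ (ℕ.≤-<-trans t<h h<p) (ℕ.∣⇒≤ (∣⇒∣ᵤ p∣1+t)))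

-- (a , b) stands for a + bφ, where φ² = φ + 1.
ℤ[φ] : Set
ℤ[φ] = ℤ Product.× ℤ

infixl 6 _⊕_
infixl 7 _⊗_

_⊕_ : ℤ[φ] → ℤ[φ] → ℤ[φ]
(a , b) ⊕ (c , d) = (a + c , b + d)

_⊗_ : ℤ[φ] → ℤ[φ] → ℤ[φ]
(a , b) ⊗ (c , d) = (a * c + b * d , a * d + b * c + b * d)

ι : ℤ → ℤ[φ]
ι a = (a , + 0)

φ : ℤ[φ]
φ = (+ 0 , + 1)

module _ where
  open import Algebra.Structures {A = ℤ[φ]} _≡_
  open import Algebra.Structures.Biased using (isCommutativeMonoidˡ; isCommutativeSemiringˡ)

  ⊕-assoc : ∀ x y z → (x ⊕ y) ⊕ z ≡ x ⊕ (y ⊕ z)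
  ⊕-assoc (a , b) (c , d) (e , f) = cong₂ _,_ (ℤ.+-assoc a c e) (ℤ.+-assoc b d f)

  ⊕-comm : ∀ x y → x ⊕ y ≡ y ⊕ x
  ⊕-comm (a , b) (c , d) = cong₂ _,_ (ℤ.+-comm a c) (ℤ.+-comm b d)

  ⊕-identityˡ : ∀ x → ι (+ 0) ⊕ x ≡ x
  ⊕-identityˡ (a , b) = cong₂ _,_ (ℤ.+-identityˡ a) (ℤ.+-identityˡ b)

  ⊗-assoc : ∀ x y z → (x ⊗ y) ⊗ z ≡ x ⊗ (y ⊗ z)
  ⊗-assoc (a , b) (c , d) (e , f) = cong₂ _,_ (fst a b c d e f) (snd a b c d e f)
    where
    fst : ∀ a b c d e f → (a * c + b * d) * e + (a * d + b * c + b * d) * f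
                        ≡ a * (c * e + d * f) + b * (c * f + d * e + d * f)
    fst = ℤ-solve-∀
    snd : ∀ a b c d e f → (a * c + b * d) * f + (a * d + b * c + b * d) * e + (a * d + b * c + b * d) * f
                        ≡ a * (c * f + d * e + d * f) + b * (c * e + d * f) + b * (c * f + d * e + d * f)
    snd = ℤ-solve-∀

  ⊗-comm : ∀ x y → x ⊗ y ≡ y ⊗ x
  ⊗-comm (a , b) (c , d) = cong₂ _,_ (fst a b c d) (snd a b c d)
    where
    fst : ∀ a b c d → a * c + b * d ≡ c * a + d * b
    fst = ℤ-solve-∀
    snd : ∀ a b c d → a * d + b * c + b * d ≡ c * b + d * a + d * b
    snd = ℤ-solve-∀

  ⊗-identityˡ : ∀ x → ι (+ 1) ⊗ x ≡ x
  ⊗-identityˡ (a , b) = cong₂ _,_ (fst a b) (snd a b)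
    where
    fst : ∀ a b → + 1 * a + + 0 * b ≡ a
    fst = ℤ-solve-∀
    snd : ∀ a b → + 1 * b + + 0 * a + + 0 * b ≡ b
    snd = ℤ-solve-∀

  ⊗-distribʳ-⊕ : ∀ x y z → (y ⊕ z) ⊗ x ≡ y ⊗ x ⊕ z ⊗ x
  ⊗-distribʳ-⊕ (a , b) (c , d) (e , f) = cong₂ _,_ (fst a b c d e f) (snd a b c d e f)
    where
    fst : ∀ a b c d e f → (c + e) * a + (d + f) * b ≡ (c * a + d * b) + (e * a + f * b)
    fst = ℤ-solve-∀
    snd : ∀ a b c d e f → (c + e) * b + (d + f) * a + (d + f) * b ≡ (c * b + d * a + d * b) + (e * b + f * a + f * b)
    snd = ℤ-solve-∀

  ⊗-zeroˡ : ∀ x → ι (+ 0) ⊗ x ≡ ι (+ 0)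
  ⊗-zeroˡ (a , b) = cong₂ _,_ (fst a b) (snd a b)
    where
    fst : ∀ a b → + 0 * a + + 0 * b ≡ + 0
    fst = ℤ-solve-∀
    snd : ∀ a b → + 0 * b + + 0 * a + + 0 * b ≡ + 0
    snd = ℤ-solve-∀

  isCommutativeMonoid : ∀ _∙_ ε → (∀ x y z → (x ∙ y) ∙ z ≡ x ∙ (y ∙ z)) → (∀ x y → x ∙ y ≡ y ∙ x) → (∀ x → ε ∙ x ≡ x) →
                        IsCommutativeMonoid _∙_ ε
  isCommutativeMonoid _∙_ ε assoc comm identityˡ = isCommutativeMonoidˡ record
    { isSemigroup = record { isMagma = record { isEquivalence = isEquivalence ; ∙-cong = cong₂ _∙_ } ; assoc = assoc }
    ; identityˡ = identityˡ
    ; comm = comm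
    }

  ℤ[φ]-commutativeSemiring : CommutativeSemiring 0ℓ 0ℓ
  ℤ[φ]-commutativeSemiring = record { isCommutativeSemiring = isCommutativeSemiringˡ record
    { +-isCommutativeMonoid = isCommutativeMonoid _⊕_ (ι (+ 0)) ⊕-assoc ⊕-comm ⊕-identityˡ
    ; *-isCommutativeMonoid = isCommutativeMonoid _⊗_ (ι (+ 1)) ⊗-assoc ⊗-comm ⊗-identityˡ
    ; distribʳ = ⊗-distribʳ-⊕
    ; zeroˡ = ⊗-zeroˡ
    } }

open CommutativeSemiring ℤ[φ]-commutativeSemiring using (semiring)
open import Algebra.Properties.Semiring.Exp semiring using (_^_; ^-homo-*; ^-assocʳ)
open import Algebra.Properties.Semiring.Mult semiring using (_×_)
open import Algebra.Properties.CommutativeSemiring.Exp ℤ[φ]-commutativeSemiring using (^-distrib-*)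

ψ : ℤ[φ]
ψ = (+ 1 , - + 1)

infix 4 _≋_mod_
record _≋_mod_ (x y : ℤ[φ]) (n : ℤ) : Set where
  constructor _,_
  field
    proj₁-≡ : Product.proj₁ x ≡ Product.proj₁ y mod n
    proj₂-≡ : Product.proj₂ x ≡ Product.proj₂ y mod n

module _ {n : ℤ} where

  ≡⇒≋ : ∀ {x y} → x ≡ y → x ≋ y mod n
  ≡⇒≋ refl = ≡⇒≡-mod refl , ≡⇒≡-mod refl

  ≋-trans : ∀ {x y z} → x ≋ y mod n → y ≋ z mod n → x ≋ z mod n
  ≋-trans (a , b) (c , d) = ≡-mod-trans a c , ≡-mod-trans b d

  ⊗-cong-mod : ∀ {x y u v} → x ≋ y mod n → u ≋ v mod n → x ⊗ u ≋ y ⊗ v mod n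
  ⊗-cong-mod (a , b) (c , d) =
    +-cong-mod (*-cong-mod a c) (*-cong-mod b d) ,
    +-cong-mod (+-cong-mod (*-cong-mod a d) (*-cong-mod b c)) (*-cong-mod b d)

  ^-cong-mod : ∀ {x y} → x ≋ y mod n → ∀ k → x ^ k ≋ y ^ k mod n
  ^-cong-mod x≋y zero    = ≡⇒≋ refl
  ^-cong-mod x≋y (suc k) = ⊗-cong-mod x≋y (^-cong-mod x≋y k)

F : ℕ → ℤ
F n = + fib n

F⁻ : ℕ → ℤ
F⁻ zero    = + 1
F⁻ (suc n) = F n

F-suc : ∀ n → F (suc n) ≡ F n + F⁻ n
F-suc zero    = refl
F-suc (suc n) = ℤ.pos-+ (fib (suc n)) (fib n)

φ⊗ : ∀ u v → φ ⊗ (u , v) ≡ (v , u + v)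
φ⊗ u v = cong₂ _,_ (fst u v) (snd u v)
  where
  fst : ∀ u v → + 0 * u + + 1 * v ≡ v
  fst = ℤ-solve-∀
  snd : ∀ u v → + 0 * v + + 1 * u + + 1 * v ≡ u + v
  snd = ℤ-solve-∀

ψ⊗ : ∀ u v → ψ ⊗ (u , v) ≡ (u - v , - u)
ψ⊗ u v = cong₂ _,_ (fst u v) (snd u v)
  where
  fst : ∀ u v → + 1 * u + - + 1 * v ≡ u - v
  fst = ℤ-solve-∀
  snd : ∀ u v → + 1 * v + - + 1 * u + - + 1 * v ≡ - u
  snd = ℤ-solve-∀

φ^n≡ : ∀ n → φ ^ n ≡ (F⁻ n , F n)
φ^n≡ zero    = refl
φ^n≡ (suc n) = begin
  φ ⊗ φ ^ n              ≡⟨ cong (φ ⊗_) (φ^n≡ n) ⟩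
  φ ⊗ (F⁻ n , F n)       ≡⟨ φ⊗ (F⁻ n) (F n) ⟩
  (F n , F⁻ n + F n)     ≡⟨ cong (F n ,_) (trans (ℤ.+-comm (F⁻ n) (F n)) (sym (F-suc n))) ⟩
  (F n , F (suc n))      ∎
  where open ≡-Reasoning

ψ^n≡ : ∀ n → ψ ^ n ≡ (F (suc n) , - F n)
ψ^n≡ zero    = refl
ψ^n≡ (suc n) = begin
  ψ ⊗ ψ ^ n                           ≡⟨ cong (ψ ⊗_) (ψ^n≡ n) ⟩
  ψ ⊗ (F (suc n) , - F n)             ≡⟨ ψ⊗ (F (suc n)) (- F n) ⟩
  (F (suc n) - - F n , - F (suc n))   ≡⟨ cong (_, - F (suc n)) (trans (lemma (F (suc n)) (F n)) (sym (F-suc (suc n)))) ⟩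
  (F (suc (suc n)) , - F (suc n))     ∎
  where
  open ≡-Reasoning
  lemma : ∀ u v → u - - v ≡ u + v
  lemma = ℤ-solve-∀

ι-⊗ : ∀ c a b → ι c ⊗ (a , b) ≡ (c * a , c * b)
ι-⊗ c a b = cong₂ _,_ (fst c a b) (snd c a b)
  where
  fst : ∀ c a b → c * a + + 0 * b ≡ c * a
  fst = ℤ-solve-∀
  snd : ∀ c a b → c * b + + 0 * a + + 0 * b ≡ c * b
  snd = ℤ-solve-∀

ι-^ : ∀ a n → ι a ^ n ≡ ι (a ℤ.^ n)
ι-^ a zero    = refl
ι-^ a (suc n) = begin
  ι a ⊗ ι a ^ n                  ≡⟨ cong (ι a ⊗_) (ι-^ a n) ⟩
  ι a ⊗ ι (a ℤ.^ n)              ≡⟨ ι-⊗ a (a ℤ.^ n) (+ 0) ⟩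
  (a * a ℤ.^ n , a * + 0)        ≡⟨ cong (a * a ℤ.^ n ,_) (ℤ.*-zeroʳ a) ⟩
  ι (a * a ℤ.^ n)                ∎
  where open ≡-Reasoning

×≡ι⊗ : ∀ m x → m × x ≡ ι (+ m) ⊗ x
×≡ι⊗ zero    (a , b) = sym (⊗-zeroˡ (a , b))
×≡ι⊗ (suc m) (a , b) = begin
  (a , b) ⊕ m × (a , b)         ≡⟨ cong ((a , b) ⊕_) (×≡ι⊗ m (a , b)) ⟩
  (a , b) ⊕ ι (+ m) ⊗ (a , b)   ≡⟨ cong ((a , b) ⊕_) (ι-⊗ (+ m) a b) ⟩
  (a + + m * a , b + + m * b)   ≡⟨ cong₂ _,_ (step (+ m) a) (step (+ m) b) ⟩
  ((+ 1 + + m) * a , (+ 1 + + m) * b) ≡⟨ ι-⊗ (+ suc m) a b ⟨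
  ι (+ suc m) ⊗ (a , b)         ∎
  where
  open ≡-Reasoning
  step : ∀ m a → a + m * a ≡ (+ 1 + m) * a
  step = ℤ-solve-∀

frobenius : ∀ {p} → Prime p → ∀ x y → (x ⊕ y) ^ p ≋ x ^ p ⊕ y ^ p mod + p
frobenius {p} pr x y with freshmans-dream ℤ[φ]-commutativeSemiring pr x y
... | (a , b) , eq = ≋-trans (≡⇒≋ (trans eq (cong (x ^ p ⊕ y ^ p ⊕_) p×M≡)))
                            (+-*-≡-mod _ a , +-*-≡-mod _ b)
  where
  p×M≡ : p × (a , b) ≡ (+ p * a , + p * b)
  p×M≡ = trans (×≡ι⊗ p (a , b)) (ι-⊗ (+ p) a b)

√5 : ℤ[φ]
√5 = (- + 1 , + 2)

√5+1≡2φ : √5 ⊕ ι (+ 1) ≡ ι (+ 2) ⊗ φ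
√5+1≡2φ = refl

√5^odd : ∀ h → √5 ^ suc (2 ℕ.* h) ≡ ((+ 5) ℤ.^ h * - + 1 , (+ 5) ℤ.^ h * + 2)
√5^odd h = begin
  √5 ⊗ √5 ^ (2 ℕ.* h)      ≡⟨ cong (√5 ⊗_) (^-assocʳ √5 2 h) ⟨
  √5 ⊗ ι (+ 5) ^ h         ≡⟨ cong (√5 ⊗_) (ι-^ (+ 5) h) ⟩
  √5 ⊗ ι ((+ 5) ℤ.^ h)       ≡⟨ ⊗-comm √5 (ι ((+ 5) ℤ.^ h)) ⟩
  ι ((+ 5) ℤ.^ h) ⊗ √5       ≡⟨ ι-⊗ ((+ 5) ℤ.^ h) (- + 1) (+ 2) ⟩
  ((+ 5) ℤ.^ h * - + 1 , (+ 5) ℤ.^ h * + 2) ∎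
  where open ≡-Reasoning

module _ (h : ℕ) (pr : Prime (suc (2 ℕ.* h))) where

  private
    p : ℕ
    p = suc (2 ℕ.* h)
    P : ℤ
    P = + p

  2^p≡2 : (+ 2) ℤ.^ p ≡ + 2 mod P
  2^p≡2 = begin
    (+ 2) ℤ.^ p                             ≡⟨ cong Product.proj₁ (ι-^ (+ 2) p) ⟨
    Product.proj₁ ((ι (+ 1) ⊕ ι (+ 1)) ^ p)   ≈⟨ _≋_mod_.proj₁-≡ (frobenius {p} pr (ι (+ 1)) (ι (+ 1))) ⟩
    Product.proj₁ (ι (+ 1) ^ p ⊕ ι (+ 1) ^ p) ≡⟨ cong (λ u → Product.proj₁ (u ⊕ u)) (ι-^ (+ 1) p) ⟩
    (+ 1) ℤ.^ p + (+ 1) ℤ.^ p                 ≡⟨ cong (λ u → u + u) (ℤ.^-zeroˡ p) ⟩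
    + 2                                     ∎
    where open ≡-mod-Reasoning P

  φ^p≋ψ : (+ 5) ℤ.^ h ≡ - + 1 mod P → φ ^ p ≋ ψ mod P
  φ^p≋ψ 5^h≡-1 = ≋-trans (≡⇒≋ (φ^n≡ p)) (cancel-2 F⁻p-equation , cancel-2 Fp-equation)
    where
    cancel-2 : ∀ {x y} → + 2 * x ≡ + 2 * y mod P → x ≡ y mod P
    cancel-2 = *-cancelˡ-≡-mod pr (odd-prime∤2 h pr)

    e : ℤ
    e = (+ 5) ℤ.^ h

    coordinates : ((+ 2) ℤ.^ p * F⁻ p , (+ 2) ℤ.^ p * F p) ≋ (e * - + 1 + + 1 , e * + 2 + + 0) mod P
    coordinates = ≋-trans (≡⇒≋ (sym expand-left)) (≋-trans (frobenius {p} pr √5 (ι (+ 1))) (≡⇒≋ expand-right))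
      where
      open ≡-Reasoning
      expand-left : (√5 ⊕ ι (+ 1)) ^ p ≡ ((+ 2) ℤ.^ p * F⁻ p , (+ 2) ℤ.^ p * F p)
      expand-left = begin
        (√5 ⊕ ι (+ 1)) ^ p               ≡⟨ cong (_^ p) √5+1≡2φ ⟩
        (ι (+ 2) ⊗ φ) ^ p                ≡⟨ ^-distrib-* (ι (+ 2)) φ p ⟩
        ι (+ 2) ^ p ⊗ φ ^ p              ≡⟨ cong₂ _⊗_ (ι-^ (+ 2) p) (φ^n≡ p) ⟩
        ι ((+ 2) ℤ.^ p) ⊗ (F⁻ p , F p)   ≡⟨ ι-⊗ ((+ 2) ℤ.^ p) (F⁻ p) (F p) ⟩
        ((+ 2) ℤ.^ p * F⁻ p , (+ 2) ℤ.^ p * F p) ∎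
      expand-right : √5 ^ p ⊕ ι (+ 1) ^ p ≡ (e * - + 1 + + 1 , e * + 2 + + 0)
      expand-right = cong₂ _⊕_ (√5^odd h) (trans (ι-^ (+ 1) p) (cong ι (ℤ.^-zeroˡ p)))

    F⁻p-equation : + 2 * F⁻ p ≡ + 2 * + 1 mod P
    F⁻p-equation = begin
      + 2 * F⁻ p                ≈⟨ *-cong-mod (≡-mod-sym 2^p≡2) (≡⇒≡-mod refl) ⟩
      (+ 2) ℤ.^ p * F⁻ p        ≈⟨ _≋_mod_.proj₁-≡ coordinates ⟩
      e * - + 1 + + 1           ≈⟨ +-cong-mod (*-cong-mod 5^h≡-1 (≡⇒≡-mod refl)) (≡⇒≡-mod refl) ⟩
      + 2 * + 1                 ∎
      where open ≡-mod-Reasoning P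

    Fp-equation : + 2 * F p ≡ + 2 * - + 1 mod P
    Fp-equation = begin
      + 2 * F p                 ≈⟨ *-cong-mod (≡-mod-sym 2^p≡2) (≡⇒≡-mod refl) ⟩
      (+ 2) ℤ.^ p * F p         ≈⟨ _≋_mod_.proj₂-≡ coordinates ⟩
      e * + 2 + + 0             ≈⟨ +-cong-mod (*-cong-mod 5^h≡-1 (≡⇒≡-mod refl)) (≡⇒≡-mod refl) ⟩
      + 2 * - + 1               ∎
      where open ≡-mod-Reasoning P

φ^p≋ψ-if-p≡7[mod10] : ∀ {p} j → p ≡ 10 ℕ.* j ℕ.+ 7 → Prime p → φ ^ p ≋ ψ mod + p
φ^p≋ψ-if-p≡7[mod10] j refl pr = subst (λ q → φ ^ q ≋ ψ mod + q) (sym p≡1+2h)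
  (φ^p≋ψ h (subst Prime p≡1+2h pr) (subst (λ q → (+ 5) ℤ.^ h ≡ - + 1 mod + q) p≡1+2h (5^[5j+3]≡-1 j pr)))
  where
  h : ℕ
  h = 5 ℕ.* j ℕ.+ 3
  lemma : ∀ j → 10 ℕ.* j ℕ.+ 7 ≡ suc (2 ℕ.* (5 ℕ.* j ℕ.+ 3))
  lemma = ℕ-solve-∀
  p≡1+2h : 10 ℕ.* j ℕ.+ 7 ≡ suc (2 ℕ.* h)
  p≡1+2h = lemma j

φ^N≋ψ³ : ∀ {n} N → φ ^ (N ℕ.+ 2) ≋ ψ mod n → φ ^ N ≋ ψ ^ 3 mod n
φ^N≋ψ³ N φ^[N+2]≋ψ = ≋-trans (≡⇒≋ φ^N≡) (⊗-cong-mod φ^[N+2]≋ψ (≡⇒≋ refl))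
  where
  open ≡-Reasoning
  φ^N≡ : φ ^ N ≡ φ ^ (N ℕ.+ 2) ⊗ ψ ^ 2
  φ^N≡ = begin
    φ ^ N                        ≡⟨ sym (trans (⊗-comm (φ ^ N) _) (⊗-identityˡ (φ ^ N))) ⟩
    φ ^ N ⊗ (φ ⊗ ψ) ^ 2          ≡⟨ cong (φ ^ N ⊗_) (^-distrib-* φ ψ 2) ⟩
    φ ^ N ⊗ (φ ^ 2 ⊗ ψ ^ 2)      ≡⟨ ⊗-assoc (φ ^ N) (φ ^ 2) (ψ ^ 2) ⟨
    φ ^ N ⊗ φ ^ 2 ⊗ ψ ^ 2        ≡⟨ cong (_⊗ ψ ^ 2) (^-homo-* φ N 2) ⟨
    φ ^ (N ℕ.+ 2) ⊗ ψ ^ 2        ∎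

F-+-≡-mod : ∀ {n} a {b c} → φ ^ c ≋ ψ ^ b mod n → F (a ℕ.+ c) ≡ F a * F⁻ b - F⁻ a * F b mod n
F-+-≡-mod {n} a {b} {c} φ^c≋ψ^b = begin
  F (a ℕ.+ c)                          ≡⟨ cong Product.proj₂ (trans (sym (^-homo-* φ a c)) (φ^n≡ (a ℕ.+ c))) ⟨
  Product.proj₂ (φ ^ a ⊗ φ ^ c)        ≈⟨ _≋_mod_.proj₂-≡ (⊗-cong-mod (≡⇒≋ {x = φ ^ a} refl) φ^c≋ψ^b) ⟩
  Product.proj₂ (φ ^ a ⊗ ψ ^ b)        ≡⟨ cong₂ (λ x y → Product.proj₂ (x ⊗ y)) (φ^n≡ a) (ψ^n≡ b) ⟩
  F⁻ a * - F b + F a * F (suc b) + F a * - F b  ≡⟨ cong (λ x → F⁻ a * - F b + F a * x + F a * - F b) (F-suc b) ⟩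
  F⁻ a * - F b + F a * (F b + F⁻ b) + F a * - F b ≡⟨ lemma (F a) (F⁻ a) (F b) (F⁻ b) ⟩
  F a * F⁻ b - F⁻ a * F b              ∎
  where
  open ≡-mod-Reasoning n
  lemma : ∀ x x⁻ y y⁻ → x⁻ * - y + x * (y + y⁻) + x * - y ≡ x * y⁻ - x⁻ * y
  lemma = ℤ-solve-∀

F-+-*-≡-mod : ∀ {n} N → φ ^ (N ℕ.+ 2) ≋ ψ mod n → ∀ a m → F (a ℕ.+ N ℕ.* m) ≡ F a * F⁻ (3 ℕ.* m) - F⁻ a * F (3 ℕ.* m) mod n
F-+-*-≡-mod N φ^[N+2]≋ψ a m = F-+-≡-mod a (≋-trans (≡⇒≋ (sym (^-assocʳ φ N m)))
                                           (≋-trans (^-cong-mod (φ^N≋ψ³ N φ^[N+2]≋ψ) m) (≡⇒≋ (^-assocʳ ψ 3 m))))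

fibℤ[n-1]≡F⁻ : ∀ n → fibℤ (+ n - + 1) ≡ F⁻ n
fibℤ[n-1]≡F⁻ zero    = refl
fibℤ[n-1]≡F⁻ (suc n) = refl

corollary3p9 : (k : ℕ) → k % 2 ≡ 1 → Prime (5 Data.Nat.* k Data.Nat.+ 2) → (m r : ℕ) →
    + (5 Data.Nat.* k Data.Nat.+ 2) ∣
      (fibℤ (+ (m Data.Nat.* (5 Data.Nat.* k Data.Nat.+ r)))
        - (fibℤ (+ (m Data.Nat.* r)) * fibℤ (+ (3 Data.Nat.* m) - + 1)
           - fibℤ (+ (m Data.Nat.* r) - + 1) * fibℤ (+ (3 Data.Nat.* m))))
corollary3p9 k k-odd pr m r = ∣⇒∣ᵤ (_≡_mod_.∣-difference (begin
  F (m ℕ.* (N ℕ.+ r))                                          ≡⟨ cong F (index m N r) ⟩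
  F (m ℕ.* r ℕ.+ N ℕ.* m)                                      ≈⟨ F-+-*-≡-mod N φ^[N+2]≋ψ (m ℕ.* r) m ⟩
  F (m ℕ.* r) * F⁻ (3 ℕ.* m) - F⁻ (m ℕ.* r) * F (3 ℕ.* m)
    ≡⟨ cong₂ (λ x y → F (m ℕ.* r) * x - y * F (3 ℕ.* m)) (fibℤ[n-1]≡F⁻ (3 ℕ.* m)) (fibℤ[n-1]≡F⁻ (m ℕ.* r)) ⟨
  fibℤ (+ (m ℕ.* r)) * fibℤ (+ (3 ℕ.* m) - + 1) - fibℤ (+ (m ℕ.* r) - + 1) * fibℤ (+ (3 ℕ.* m)) ∎))
  where
  open ≡-mod-Reasoning (+ (5 ℕ.* k ℕ.+ 2))
  N : ℕ
  N = 5 ℕ.* k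
  index : ∀ m N r → m ℕ.* (N ℕ.+ r) ≡ m ℕ.* r ℕ.+ N ℕ.* m
  index = ℕ-solve-∀
  p≡10[k/2]+7 : 5 ℕ.* k ℕ.+ 2 ≡ 10 ℕ.* (k / 2) ℕ.+ 7
  p≡10[k/2]+7 = trans (cong (λ k → 5 ℕ.* k ℕ.+ 2) (trans (m≡m%n+[m/n]*n k 2) (cong (ℕ._+ k / 2 ℕ.* 2) k-odd))) (lemma (k / 2))
    where
    lemma : ∀ j → 5 ℕ.* (1 ℕ.+ j ℕ.* 2) ℕ.+ 2 ≡ 10 ℕ.* j ℕ.+ 7
    lemma = ℕ-solve-∀
  φ^[N+2]≋ψ : φ ^ (N ℕ.+ 2) ≋ ψ mod + (N ℕ.+ 2)
  φ^[N+2]≋ψ = φ^p≋ψ-if-p≡7[mod10] (k / 2) p≡10[k/2]+7 pr
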